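{- Let $(R,\mathfrak M)$ be a local integral domain and $R\subseteq\mathcal O$ a dominant valuation overring such that the structure $(R,\mathcal O)$ is dp-minimal. If $\mathcal O$ has property $(\star)$ then so does $R$.
   Context: A valuation overring $\mathcal O$ of $R$ is a valuation ring with $R\subseteq\mathcal O\subseteq\mathrm{Frac}(R)$; it is dominant if $\mathfrak M\subseteq\mathfrak m$, where $\mathfrak m$ is the maximal ideal of $\mathcal O$. The structure $(R,\mathcal O)$ is $\mathrm{Frac}(R)$ with ring operations and unary predicates for $R$ and $\mathcal O$. For a domain whose prime spectrum is linearly ordered by inclusion, property $(\star)$ means there are no three consecutive elements in its prime spectrum, i.e. no primes $\mathfrak p_1\subsetneq\mathfrak p_2\subsetneq\mathfrak p_3$ with no prime strictly between $\mathfrak p_1,\mathfrak p_2$ nor strictly between $\mathfrak p_2,\mathfrak p_3$. -}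

module Defs where

open import Level using (0ℓ)
open import Algebra.Bundles using (CommutativeRing)
open import Data.Nat using (ℕ; suc)
open import Data.Fin using (Fin; zero)
open import Data.Product using (Σ; ∃; _×_; _,_)
open import Data.Sum using (_⊎_)
open import Data.Empty using (⊥)
open import Data.Unit using (⊤)
open import Relation.Nullary using (¬_)
open import Relation.Unary using (Pred; _∈_; _⊆_)
open import Relation.Binary.PropositionalEquality using (_≡_)
open import Function.Bundles using (_⇔_)

-- First-order language of rings with two unary predicates (for R and O).
-- Variables are de Bruijn indices Fin n.

data Term (n : ℕ) : Set where
  var  : Fin n → Term n
  zer  : Term n
  one  : Term n
  add  : Term n → Term n → Term n
  mul  : Term n → Term n → Term n
  neg  : Term n → Term n

data Formula (n : ℕ) : Set where
  eqF   : Term n → Term n → Formula n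
  inR   : Term n → Formula n
  inO   : Term n → Formula n
  falseF : Formula n
  trueF  : Formula n
  notF  : Formula n → Formula n
  andF  : Formula n → Formula n → Formula n
  orF   : Formula n → Formula n → Formula n
  allF  : Formula (suc n) → Formula n
  exF   : Formula (suc n) → Formula n

module Over (K : CommutativeRing 0ℓ 0ℓ) where
  open CommutativeRing K

  _∷ₑ_ : ∀ {n} → Carrier → (Fin n → Carrier) → Fin (suc n) → Carrier
  (c ∷ₑ ρ) zero = c
  (c ∷ₑ ρ) (Data.Fin.suc i) = ρ i

  IsField : Set
  IsField = (¬ (1# ≈ 0#)) × (∀ x → ¬ (x ≈ 0#) → ∃ λ y → x * y ≈ 1#)

  Respects≈ : Pred Carrier 0ℓ → Set
  Respects≈ P = ∀ {x y} → x ≈ y → P x → P y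

  IsSubring : Pred Carrier 0ℓ → Set
  IsSubring A = Respects≈ A × (0# ∈ A) × (1# ∈ A)
    × (∀ {x y} → x ∈ A → y ∈ A → (x + y) ∈ A)
    × (∀ {x} → x ∈ A → (- x) ∈ A)
    × (∀ {x y} → x ∈ A → y ∈ A → (x * y) ∈ A)

  IsFractionFieldOf : Pred Carrier 0ℓ → Set
  IsFractionFieldOf A = ∀ x → ∃ λ a → ∃ λ b →
    a ∈ A × b ∈ A × ¬ (b ≈ 0#) × (x * b ≈ a)

  IsValuationRing : Pred Carrier 0ℓ → Set
  IsValuationRing O = IsSubring O ×
    (∀ x → ¬ (x ≈ 0#) → x ∈ O ⊎ (∃ λ y → (x * y ≈ 1#) × y ∈ O))

  -- the non-units of a subring A (for a valuation ring: its maximal ideal)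
  NonUnits : Pred Carrier 0ℓ → Pred Carrier 0ℓ
  NonUnits A x = x ∈ A × ¬ (∃ λ y → y ∈ A × (x * y ≈ 1#))

  IsIdeal : Pred Carrier 0ℓ → Pred Carrier 0ℓ → Set
  IsIdeal A P = Respects≈ P × (P ⊆ A) × (0# ∈ P)
    × (∀ {x y} → x ∈ P → y ∈ P → (x + y) ∈ P)
    × (∀ {a x} → a ∈ A → x ∈ P → (a * x) ∈ P)

  IsProperIdeal : Pred Carrier 0ℓ → Pred Carrier 0ℓ → Set
  IsProperIdeal A P = IsIdeal A P × ¬ (1# ∈ P)

  IsPrimeIdeal : Pred Carrier 0ℓ → Pred Carrier 0ℓ → Set
  IsPrimeIdeal A P = IsProperIdeal A P ×
    (∀ {x y} → x ∈ A → y ∈ A → (x * y) ∈ P → x ∈ P ⊎ y ∈ P)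

  IsMaximalIdeal : Pred Carrier 0ℓ → Pred Carrier 0ℓ → Set₁
  IsMaximalIdeal A P = IsProperIdeal A P ×
    (∀ Q → IsProperIdeal A Q → P ⊆ Q → Q ⊆ P)

  IsLocalWith : Pred Carrier 0ℓ → Pred Carrier 0ℓ → Set₁
  IsLocalWith A M = IsMaximalIdeal A M ×
    (∀ Q → IsMaximalIdeal A Q → (Q ⊆ M) × (M ⊆ Q))

  _⊊_ : Pred Carrier 0ℓ → Pred Carrier 0ℓ → Set
  P ⊊ Q = (P ⊆ Q) × ¬ (Q ⊆ P)

  Consecutive : Pred Carrier 0ℓ → Pred Carrier 0ℓ → Pred Carrier 0ℓ → Set₁
  Consecutive A P Q = (P ⊊ Q) ×
    ¬ (Σ (Pred Carrier 0ℓ) λ T → IsPrimeIdeal A T × (P ⊊ T) × (T ⊊ Q))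

  Star : Pred Carrier 0ℓ → Set₁
  Star A = ¬ (Σ (Pred Carrier 0ℓ) λ P₁ → Σ (Pred Carrier 0ℓ) λ P₂ →
    Σ (Pred Carrier 0ℓ) λ P₃ →
      IsPrimeIdeal A P₁ × IsPrimeIdeal A P₂ × IsPrimeIdeal A P₃ ×
      Consecutive A P₁ P₂ × Consecutive A P₂ P₃)

  module Sem (R O : Pred Carrier 0ℓ) where
    evalT : ∀ {n} → (Fin n → Carrier) → Term n → Carrier
    evalT ρ (var i) = ρ i
    evalT ρ zer = 0#
    evalT ρ one = 1#
    evalT ρ (add s t) = evalT ρ s + evalT ρ t
    evalT ρ (mul s t) = evalT ρ s * evalT ρ t
    evalT ρ (neg t) = - evalT ρ t

    Sat : ∀ {n} → (Fin n → Carrier) → Formula n → Set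
    Sat ρ (eqF s t) = evalT ρ s ≈ evalT ρ t
    Sat ρ (inR t) = R (evalT ρ t)
    Sat ρ (inO t) = O (evalT ρ t)
    Sat ρ falseF = ⊥
    Sat ρ trueF = ⊤
    Sat ρ (notF φ) = ¬ Sat ρ φ
    Sat ρ (andF φ ψ) = Sat ρ φ × Sat ρ ψ
    Sat ρ (orF φ ψ) = Sat ρ φ ⊎ Sat ρ ψ
    Sat ρ (allF φ) = ∀ c → Sat (c ∷ₑ ρ) φ
    Sat ρ (exF φ) = ∃ λ c → Sat (c ∷ₑ ρ) φ

    -- ict-pattern of depth 2 in one object variable x (variable 0),
    -- finitary version realised in the structure itself: for every n
    -- there are parameters a₁..aₙ, b₁..bₙ such that for all i, j some c
    -- satisfies φ(c, a_k) iff k = i and ψ(c, b_l) iff l = j.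
    HasICTPattern2 : Set
    HasICTPattern2 = Σ ℕ λ k → Σ ℕ λ m →
      Σ (Formula (suc k)) λ φ → Σ (Formula (suc m)) λ ψ →
      ∀ (n : ℕ) → Σ (Fin n → Fin k → Carrier) λ a →
        Σ (Fin n → Fin m → Carrier) λ b →
        ∀ (i j : Fin n) → ∃ λ c →
          (∀ i′ → Sat (c ∷ₑ a i′) φ ⇔ (i′ ≡ i)) ×
          (∀ j′ → Sat (c ∷ₑ b j′) ψ ⇔ (j′ ≡ j))

    DPMinimal : Set
    DPMinimal = ¬ HasICTPattern2

{-# OPTIONS --safe #-}
module Submission where

-- Every prime P of R extends to the prime Rad(P·O) of O, and this extension sends
-- consecutive primes of R to consecutive primes of O, so three consecutive primes of R
-- would give three in O.  Both facts needed for this come from dp-minimality: if the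
-- cosets xᵢ + e₁⁻¹S₁ are pairwise distinct, the yⱼ·e₁ lie in S₁, and symmetrically for
-- (yⱼ, e₂, S₂), then cᵢⱼ = xᵢ + yⱼ and the formulas (c − a)·e ∈ Sₖ (Sₖ ∈ {R, O}) form an
-- ICT pattern of depth 2.  Taking the xᵢ, yⱼ to be powers of a suitable element of 𝔪, this
-- excludes (1) an element of R ∖ P of the form p·o, so Rad(P·O) ∩ R = P, and (2) primes
-- q ⊊ q′ of O such that R ∩ 𝔪 ⊄ q but R ∩ q′ ⊆ q.  A prime of O strictly between
-- Rad(A·O) and Rad(B·O) would then contract to a prime strictly between A and B.

open import Defs
open import Level using (0ℓ)
import Level
open import Algebra.Bundles using (CommutativeRing)
open import Axiom.ExcludedMiddle using (ExcludedMiddle)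
open import Axiom.DoubleNegationElimination using (em⇒dne)
open import Data.Empty using (⊥; ⊥-elim)
open import Data.Fin.Base as Fin using (Fin; toℕ) renaming (zero to fzero; suc to fsuc)
import Data.Fin.Properties as Fin
open import Data.Integer.Base as ℤ using (ℤ; +_; -[1+_]; _⊖_; sign; ∣_∣; _◃_)
import Data.Integer.Properties as ℤ
open import Data.Maybe.Base using (Maybe; just; nothing)
open import Data.Nat.Base as ℕ using (ℕ; zero; suc)
import Data.Nat.Properties as ℕ
open import Data.Product using (_×_; _,_; Σ; ∃; proj₁; proj₂)
open import Data.Sign.Base as Sign using (Sign)
open import Data.Sum using (_⊎_; inj₁; inj₂; [_,_])
open import Function.Base using (id)
open import Function.Bundles using (_⇔_; mk⇔)
open import Function.Properties.Equivalence using () renaming (trans to ⇔-trans)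
open import Relation.Binary.Core using (Rel)
open import Relation.Binary.Definitions using (Symmetric; Trichotomous; tri<; tri≈; tri>)
open import Relation.Binary.PropositionalEquality as ≡ using (_≡_)
open import Relation.Nullary using (¬_; yes; no)
open import Relation.Unary using (Pred; _∈_; _∉_; _⊆_; _∩_)
import Algebra.Solver.Ring as RingSolver
open import Algebra.Solver.Ring.AlmostCommutativeRing
  using (fromCommutativeRing; _-Raw-AlmostCommutative⟶_)

-- The ring solver normalises coefficients by computation, so they are taken in ℤ and
-- mapped into K.
module IntegerCoefficients {c ℓ} (K : CommutativeRing c ℓ) where
  open CommutativeRing K
  open import Algebra.Properties.Ring ring using (-1*x≈-x)
  open import Algebra.Properties.Group +-group using (ε⁻¹≈ε; ⁻¹-involutive)
  open import Algebra.Properties.AbelianGroup +-abelianGroup using (⁻¹-∙-comm)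
  open import Algebra.Properties.Semiring.Mult.TCOptimised semiring
    using (×-homo-+; ×1-homo-*) renaming (_×_ to _·_)
  open import Algebra.Properties.CommutativeSemigroup *-commutativeSemigroup
    using () renaming (interchange to *-interchange)
  open import Algebra.Properties.CommutativeSemigroup +-commutativeSemigroup
    using () renaming (interchange to +-interchange)
  open import Relation.Binary.Reasoning.Setoid setoid

  ⟦_⟧ℤ : ℤ → Carrier
  ⟦ + n ⟧ℤ      = n · 1#
  ⟦ -[1+ n ] ⟧ℤ = - (suc n · 1#)

  ⟦_⟧± : Sign → Carrier
  ⟦ Sign.+ ⟧± = 1#
  ⟦ Sign.- ⟧± = - 1#

  ⟦⟧±-homo-* : ∀ s t → ⟦ s Sign.* t ⟧± ≈ ⟦ s ⟧± * ⟦ t ⟧±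
  ⟦⟧±-homo-* Sign.+ t       = sym (*-identityˡ _)
  ⟦⟧±-homo-* Sign.- Sign.+ = sym (*-identityʳ _)
  ⟦⟧±-homo-* Sign.- Sign.- = sym (trans (-1*x≈-x (- 1#)) (⁻¹-involutive 1#))

  ⟦◃⟧ℤ : ∀ s n → ⟦ s ◃ n ⟧ℤ ≈ ⟦ s ⟧± * (n · 1#)
  ⟦◃⟧ℤ Sign.+ n       = trans (reflexive (≡.cong ⟦_⟧ℤ (ℤ.+◃n≡+n n))) (sym (*-identityˡ _))
  ⟦◃⟧ℤ Sign.- zero    = sym (zeroʳ _)
  ⟦◃⟧ℤ Sign.- (suc n) = sym (-1*x≈-x _)

  ⟦⟧ℤ-sign-abs : ∀ i → ⟦ i ⟧ℤ ≈ ⟦ sign i ⟧± * (∣ i ∣ · 1#)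
  ⟦⟧ℤ-sign-abs i = trans (reflexive (≡.cong ⟦_⟧ℤ (≡.sym (ℤ.◃-inverse i)))) (⟦◃⟧ℤ (sign i) ∣ i ∣)

  ⟦⟧ℤ-homo-⊖ : ∀ m n → ⟦ m ⊖ n ⟧ℤ ≈ m · 1# - n · 1#
  ⟦⟧ℤ-homo-⊖ zero    zero    = sym (-‿inverseʳ 0#)
  ⟦⟧ℤ-homo-⊖ zero    (suc n) = sym (+-identityˡ _)
  ⟦⟧ℤ-homo-⊖ (suc m) zero    = sym (trans (+-congˡ ε⁻¹≈ε) (+-identityʳ _))
  ⟦⟧ℤ-homo-⊖ (suc m) (suc n) = begin
    ⟦ suc m ⊖ suc n ⟧ℤ                ≡⟨ ≡.cong ⟦_⟧ℤ (ℤ.[1+m]⊖[1+n]≡m⊖n m n) ⟩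
    ⟦ m ⊖ n ⟧ℤ                        ≈⟨ ⟦⟧ℤ-homo-⊖ m n ⟩
    m · 1# - n · 1#                   ≈⟨ +-identityˡ _ ⟨
    0# + (m · 1# - n · 1#)            ≈⟨ +-congʳ (-‿inverseʳ 1#) ⟨
    (1# - 1#) + (m · 1# - n · 1#)     ≈⟨ +-interchange 1# (- 1#) (m · 1#) (- (n · 1#)) ⟩
    (1# + m · 1#) + (- 1# - n · 1#)   ≈⟨ +-congˡ (⁻¹-∙-comm 1# (n · 1#)) ⟩
    (1# + m · 1#) - (1# + n · 1#)     ≈⟨ +-cong (×-homo-+ 1# 1 m) (-‿cong (×-homo-+ 1# 1 n)) ⟨
    suc m · 1# - suc n · 1#           ∎

  ⟦⟧ℤ-homo-+ : ∀ i j → ⟦ i ℤ.+ j ⟧ℤ ≈ ⟦ i ⟧ℤ + ⟦ j ⟧ℤ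
  ⟦⟧ℤ-homo-+ (+ m)      (+ n)      = ×-homo-+ 1# m n
  ⟦⟧ℤ-homo-+ (+ m)      -[1+ n ]   = ⟦⟧ℤ-homo-⊖ m (suc n)
  ⟦⟧ℤ-homo-+ -[1+ m ]   (+ n)      = trans (⟦⟧ℤ-homo-⊖ n (suc m)) (+-comm _ _)
  ⟦⟧ℤ-homo-+ -[1+ m ]   -[1+ n ]   = begin
    - (suc (suc (m ℕ.+ n)) · 1#)      ≡⟨ ≡.cong (λ k → - (suc k · 1#)) (ℕ.+-suc m n) ⟨
    - ((suc m ℕ.+ suc n) · 1#)        ≈⟨ -‿cong (×-homo-+ 1# (suc m) (suc n)) ⟩
    - (suc m · 1# + suc n · 1#)       ≈⟨ ⁻¹-∙-comm _ _ ⟨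
    - (suc m · 1#) + - (suc n · 1#)   ∎

  ⟦⟧ℤ-homo-* : ∀ i j → ⟦ i ℤ.* j ⟧ℤ ≈ ⟦ i ⟧ℤ * ⟦ j ⟧ℤ
  ⟦⟧ℤ-homo-* i j = begin
    ⟦ sign i Sign.* sign j ◃ ∣ i ∣ ℕ.* ∣ j ∣ ⟧ℤ
      ≈⟨ ⟦◃⟧ℤ (sign i Sign.* sign j) (∣ i ∣ ℕ.* ∣ j ∣) ⟩
    ⟦ sign i Sign.* sign j ⟧± * ((∣ i ∣ ℕ.* ∣ j ∣) · 1#)
      ≈⟨ *-cong (⟦⟧±-homo-* (sign i) (sign j)) (×1-homo-* ∣ i ∣ ∣ j ∣) ⟩
    (⟦ sign i ⟧± * ⟦ sign j ⟧±) * ((∣ i ∣ · 1#) * (∣ j ∣ · 1#))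
      ≈⟨ *-interchange _ _ _ _ ⟩
    (⟦ sign i ⟧± * (∣ i ∣ · 1#)) * (⟦ sign j ⟧± * (∣ j ∣ · 1#))
      ≈⟨ *-cong (⟦⟧ℤ-sign-abs i) (⟦⟧ℤ-sign-abs j) ⟨
    ⟦ i ⟧ℤ * ⟦ j ⟧ℤ ∎

  ⟦⟧ℤ-homo-neg : ∀ i → ⟦ ℤ.- i ⟧ℤ ≈ - ⟦ i ⟧ℤ
  ⟦⟧ℤ-homo-neg (+ zero)  = sym ε⁻¹≈ε
  ⟦⟧ℤ-homo-neg (+ suc n) = refl
  ⟦⟧ℤ-homo-neg -[1+ n ]  = sym (⁻¹-involutive _)

  ℤ⟶K : CommutativeRing.rawRing ℤ.+-*-commutativeRing
          -Raw-AlmostCommutative⟶ fromCommutativeRing K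
  ℤ⟶K = record
    { ⟦_⟧ = ⟦_⟧ℤ ; +-homo = ⟦⟧ℤ-homo-+ ; *-homo = ⟦⟧ℤ-homo-* ; -‿homo = ⟦⟧ℤ-homo-neg
    ; 0-homo = refl ; 1-homo = refl }

  ⟦⟧ℤ-≟ : ∀ i j → Maybe (⟦ i ⟧ℤ ≈ ⟦ j ⟧ℤ)
  ⟦⟧ℤ-≟ i j with i ℤ.≟ j
  ... | yes i≡j = just (reflexive (≡.cong ⟦_⟧ℤ i≡j))
  ... | no _    = nothing

  open RingSolver (CommutativeRing.rawRing ℤ.+-*-commutativeRing) (fromCommutativeRing K) ℤ⟶K ⟦⟧ℤ-≟
    public using (solve; _:=_; _:+_; _:*_; _:-_; con)

⊈⇒∃∉ : ExcludedMiddle 0ℓ → ∀ {A : Set} {X Y : Pred A 0ℓ} → ¬ (X ⊆ Y) → ∃ λ x → x ∈ X × x ∉ Y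
⊈⇒∃∉ em X⊈Y = em⇒dne em (λ none → X⊈Y (λ {x} x∈X → em⇒dne em (λ x∉Y → none (x , x∈X , x∉Y))))

tri⇒≡-wlog : ∀ {A : Set} {_<_ D : Rel A 0ℓ} → Trichotomous _≡_ _<_ → Symmetric D →
  (∀ {i j} → i < j → ¬ D i j) → ∀ {i j} → D i j → i ≡ j
tri⇒≡-wlog cmp D-sym <-free {i} {j} d with cmp i j
... | tri< i<j _ _ = ⊥-elim (<-free i<j d)
... | tri≈ _ i≡j _ = i≡j
... | tri> _ _ j<i = ⊥-elim (<-free j<i (D-sym d))

module _ (K : CommutativeRing 0ℓ 0ℓ) where
  open CommutativeRing K
  open Over K
  open IntegerCoefficients K
  open import Algebra.Properties.Semiring.Exp semiring using (_^_; ^-congˡ; ^-congʳ; ^-homo-*)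
  open import Algebra.Properties.CommutativeSemiring.Exp commutativeSemiring using (^-distrib-*)
  open import Algebra.Properties.AbelianGroup +-abelianGroup using (⁻¹-anti-homo‿-)
  open import Algebra.Properties.Ring ring using (-1*x≈-x; -‿distribˡ-*)
  open import Relation.Binary.Reasoning.Setoid setoid

  Unit : Pred Carrier 0ℓ → Pred Carrier 0ℓ
  Unit A x = ∃ λ y → y ∈ A × x * y ≈ 1#

  1#^n≈1# : ∀ n → 1# ^ n ≈ 1#
  1#^n≈1# zero    = refl
  1#^n≈1# (suc n) = trans (*-identityˡ _) (1#^n≈1# n)

  ^-split : ∀ x {i j} → i ℕ.< j → ∃ λ k → x ^ j ≈ x ^ i * x ^ suc k
  ^-split x {i} i<j with ℕ.m≤n⇒∃[o]m+o≡n i<j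
  ... | k , ≡.refl = k , trans (^-congʳ x (≡.sym (ℕ.+-suc i k))) (^-homo-* x i (suc k))

  module Subring {A : Pred Carrier 0ℓ} (A-sub : IsSubring A) where
    ∈-resp-≈ : Respects≈ A
    ∈-resp-≈ = proj₁ A-sub

    0∈ : 0# ∈ A
    0∈ = proj₁ (proj₂ A-sub)

    1∈ : 1# ∈ A
    1∈ = proj₁ (proj₂ (proj₂ A-sub))

    +-closed : ∀ {x y} → x ∈ A → y ∈ A → x + y ∈ A
    +-closed = proj₁ (proj₂ (proj₂ (proj₂ A-sub)))

    neg-closed : ∀ {x} → x ∈ A → - x ∈ A
    neg-closed = proj₁ (proj₂ (proj₂ (proj₂ (proj₂ A-sub))))

    *-closed : ∀ {x y} → x ∈ A → y ∈ A → x * y ∈ A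
    *-closed = proj₂ (proj₂ (proj₂ (proj₂ (proj₂ A-sub))))

    -‿closed : ∀ {x y} → x ∈ A → y ∈ A → x - y ∈ A
    -‿closed x∈A y∈A = +-closed x∈A (neg-closed y∈A)

    ^-closed : ∀ {x} n → x ∈ A → x ^ n ∈ A
    ^-closed zero    _   = 1∈
    ^-closed (suc n) x∈A = *-closed x∈A (^-closed n x∈A)

    -‿*-sym : ∀ {a b e} → (a - b) * e ∈ A → (b - a) * e ∈ A
    -‿*-sym {a} {b} {e} [a-b]e∈A =
      ∈-resp-≈ (trans (-‿distribˡ-* _ e) (*-congʳ (⁻¹-anti-homo‿- a b))) (neg-closed [a-b]e∈A)

  module Ideal {A I : Pred Carrier 0ℓ} (I-ideal : IsIdeal A I) where
    ∈-resp-≈ : Respects≈ I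
    ∈-resp-≈ = proj₁ I-ideal

    ⊆carrier : I ⊆ A
    ⊆carrier = proj₁ (proj₂ I-ideal)

    0∈ : 0# ∈ I
    0∈ = proj₁ (proj₂ (proj₂ I-ideal))

    +-closed : ∀ {x y} → x ∈ I → y ∈ I → x + y ∈ I
    +-closed = proj₁ (proj₂ (proj₂ (proj₂ I-ideal)))

    *-closedˡ : ∀ {a x} → a ∈ A → x ∈ I → a * x ∈ I
    *-closedˡ = proj₂ (proj₂ (proj₂ (proj₂ I-ideal)))

    *-closedʳ : ∀ {x a} → x ∈ I → a ∈ A → x * a ∈ I
    *-closedʳ x∈I a∈A = ∈-resp-≈ (*-comm _ _) (*-closedˡ a∈A x∈I)

  module PrimeIdeal {A P : Pred Carrier 0ℓ} (A-sub : IsSubring A) (P-prime : IsPrimeIdeal A P) where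
    private module SA = Subring A-sub
    open Ideal (proj₁ (proj₁ P-prime)) public

    1∉ : 1# ∉ P
    1∉ = proj₂ (proj₁ P-prime)

    prime : ∀ {x y} → x ∈ A → y ∈ A → x * y ∈ P → x ∈ P ⊎ y ∈ P
    prime = proj₂ P-prime

    neg-closed : ∀ {x} → x ∈ P → - x ∈ P
    neg-closed x∈P = ∈-resp-≈ (-1*x≈-x _) (*-closedˡ (SA.neg-closed SA.1∈) x∈P)

    -‿closed : ∀ {x y} → x ∈ P → y ∈ P → x - y ∈ P
    -‿closed x∈P y∈P = +-closed x∈P (neg-closed y∈P)

    ^-prime : ∀ {x} n → x ∈ A → x ^ n ∈ P → x ∈ P
    ^-prime zero    _   1∈P = ⊥-elim (1∉ 1∈P)
    ^-prime (suc n) x∈A xxⁿ∈P with prime x∈A (SA.^-closed n x∈A) xxⁿ∈P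
    ... | inj₁ x∈P  = x∈P
    ... | inj₂ xⁿ∈P = ^-prime n x∈A xⁿ∈P

    -‿sym : ∀ {x y} → x - y ∈ P → y - x ∈ P
    -‿sym x-y∈P = ∈-resp-≈ (⁻¹-anti-homo‿- _ _) (neg-closed x-y∈P)

  ∩-prime : ∀ {A B q} → IsSubring A → IsSubring B → A ⊆ B → IsPrimeIdeal B q →
    IsPrimeIdeal A (q ∩ A)
  ∩-prime {A} {B} {q} A-sub B-sub A⊆B q-prime =
    ((resp , proj₂ , (Q.0∈ , SA.0∈) , plus , times) , (λ (1∈q , _) → Q.1∉ 1∈q)) , prime
    where
    module SA = Subring A-sub
    module Q = PrimeIdeal B-sub q-prime
    resp : Respects≈ (q ∩ A)
    resp x≈y (x∈q , x∈A) = Q.∈-resp-≈ x≈y x∈q , SA.∈-resp-≈ x≈y x∈A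
    plus : ∀ {x y} → x ∈ q ∩ A → y ∈ q ∩ A → x + y ∈ q ∩ A
    plus (x∈q , x∈A) (y∈q , y∈A) = Q.+-closed x∈q y∈q , SA.+-closed x∈A y∈A
    times : ∀ {a x} → a ∈ A → x ∈ q ∩ A → a * x ∈ q ∩ A
    times a∈A (x∈q , x∈A) = Q.*-closedˡ (A⊆B a∈A) x∈q , SA.*-closed a∈A x∈A
    prime : ∀ {x y} → x ∈ A → y ∈ A → x * y ∈ q ∩ A → x ∈ q ∩ A ⊎ y ∈ q ∩ A
    prime x∈A y∈A (xy∈q , _) with Q.prime (A⊆B x∈A) (A⊆B y∈A) xy∈q
    ... | inj₁ x∈q = inj₁ (x∈q , x∈A)
    ... | inj₂ y∈q = inj₂ (y∈q , y∈A)

  module _ (F : IsField) where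
    1≉0 : 1# ≉ 0#
    1≉0 = proj₁ F

    inverse : ∀ x → x ≉ 0# → ∃ λ y → x * y ≈ 1#
    inverse = proj₂ F

    *-cancelˡ-≉0 : ∀ {x a b} → x ≉ 0# → x * a ≈ x * b → a ≈ b
    *-cancelˡ-≉0 {x} {a} {b} x≉0 xa≈xb with inverse x x≉0
    ... | y , xy≈1 = begin
      a               ≈⟨ *-identityˡ a ⟨
      1# * a          ≈⟨ *-congʳ xy≈1 ⟨
      (x * y) * a     ≈⟨ solve 3 (λ x y a → (x :* y) :* a := y :* (x :* a)) refl x y a ⟩
      y * (x * a)     ≈⟨ *-congˡ xa≈xb ⟩
      y * (x * b)     ≈⟨ solve 3 (λ x y b → y :* (x :* b) := (x :* y) :* b) refl x y b ⟩
      (x * y) * b     ≈⟨ *-congʳ xy≈1 ⟩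
      1# * b          ≈⟨ *-identityˡ b ⟩
      b               ∎

    *-≉0 : ∀ {x y} → x ≉ 0# → y ≉ 0# → x * y ≉ 0#
    *-≉0 {x} x≉0 y≉0 xy≈0 = y≉0 (*-cancelˡ-≉0 x≉0 (trans xy≈0 (sym (zeroʳ x))))

    ^-≉0 : ∀ {x} → x ≉ 0# → ∀ n → x ^ n ≉ 0#
    ^-≉0 x≉0 zero    = 1≉0
    ^-≉0 x≉0 (suc n) = *-≉0 x≉0 (^-≉0 x≉0 n)

    module _ (em : ExcludedMiddle 0ℓ) {O : Pred Carrier 0ℓ} (O-val : IsValuationRing O) where
      O-sub : IsSubring O
      O-sub = proj₁ O-val

      private module SO = Subring O-sub

      𝔪 : Pred Carrier 0ℓ
      𝔪 = NonUnits O

      𝔪-resp-≈ : Respects≈ 𝔪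
      𝔪-resp-≈ x≈y (x∈O , x-nonunit) =
        SO.∈-resp-≈ x≈y x∈O , λ (c , c∈O , yc≈1) → x-nonunit (c , c∈O , trans (*-congʳ x≈y) yc≈1)

      1∉𝔪 : 1# ∉ 𝔪
      1∉𝔪 (_ , 1-nonunit) = 1-nonunit (1# , SO.1∈ , *-identityˡ 1#)

      𝔪-*-closedʳ : ∀ {b a} → b ∈ 𝔪 → a ∈ O → b * a ∈ 𝔪
      𝔪-*-closedʳ {b} {a} (b∈O , b-nonunit) a∈O = SO.*-closed b∈O a∈O ,
        λ (c , c∈O , bac≈1) → b-nonunit (a * c , SO.*-closed a∈O c∈O , trans (sym (*-assoc b a c)) bac≈1)

      ^suc∈𝔪 : ∀ {z} → z ∈ 𝔪 → ∀ k → z ^ suc k ∈ 𝔪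
      ^suc∈𝔪 z∈𝔪 k = 𝔪-*-closedʳ z∈𝔪 (SO.^-closed k (proj₁ z∈𝔪))

      _∣ᴼ_ : Carrier → Carrier → Set
      x ∣ᴼ y = ∃ λ w → w ∈ O × y ≈ x * w

      ∣ᴼ-total : ∀ {x y} → x ∈ O → y ∈ O → x ∣ᴼ y ⊎ y ∣ᴼ x
      ∣ᴼ-total {x} {y} x∈O y∈O with em {x ≈ 0#}
      ... | yes x≈0 = inj₂ (0# , SO.0∈ , trans x≈0 (sym (zeroʳ y)))
      ... | no x≉0 with inverse x x≉0
      ...   | x⁻¹ , xx⁻¹≈1 with em {y * x⁻¹ ∈ O}
      ...     | yes t∈O = inj₁ (y * x⁻¹ , t∈O , (begin
                y                 ≈⟨ *-identityʳ y ⟨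
                y * 1#            ≈⟨ *-congˡ xx⁻¹≈1 ⟨
                y * (x * x⁻¹)     ≈⟨ solve 3 (λ y x i → y :* (x :* i) := x :* (y :* i)) refl y x x⁻¹ ⟩
                x * (y * x⁻¹)     ∎))
      ...     | no t∉O with proj₂ O-val (y * x⁻¹) (λ t≈0 → t∉O (SO.∈-resp-≈ (sym t≈0) SO.0∈))
      ...       | inj₁ t∈O = ⊥-elim (t∉O t∈O)
      ...       | inj₂ (w , tw≈1 , w∈O) = inj₂ (w , w∈O , (begin
                x                     ≈⟨ *-identityʳ x ⟨
                x * 1#                ≈⟨ *-congˡ tw≈1 ⟨
                x * ((y * x⁻¹) * w)   ≈⟨ solve 4 (λ x y i w → x :* ((y :* i) :* w) := (x :* i) :* (y :* w))
                                                 refl x y x⁻¹ w ⟩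
                (x * x⁻¹) * (y * w)   ≈⟨ *-congʳ xx⁻¹≈1 ⟩
                1# * (y * w)          ≈⟨ *-identityˡ _ ⟩
                y * w                 ∎))

      *ᴼ-closed⇒+-closed : ∀ {S : Pred Carrier 0ℓ} → Respects≈ S → S ⊆ O →
        (∀ {x c} → x ∈ S → c ∈ O → x * c ∈ S) → ∀ {x y} → x ∈ S → y ∈ S → x + y ∈ S
      *ᴼ-closed⇒+-closed {S} S-resp S⊆O *ᴼ-closed {x} {y} x∈S y∈S with ∣ᴼ-total (S⊆O x∈S) (S⊆O y∈S)
      ... | inj₁ (w , w∈O , y≈xw) = S-resp
        (sym (trans (+-congˡ y≈xw) (solve 2 (λ x w → x :+ x :* w := x :* (con (+ 1) :+ w)) refl x w)))
        (*ᴼ-closed x∈S (SO.+-closed SO.1∈ w∈O))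
      ... | inj₂ (w , w∈O , x≈yw) = S-resp
        (sym (trans (+-congʳ x≈yw) (solve 2 (λ y w → y :* w :+ y := y :* (w :+ con (+ 1))) refl y w)))
        (*ᴼ-closed y∈S (SO.+-closed w∈O SO.1∈))

      𝔪-+-closed : ∀ {a b} → a ∈ 𝔪 → b ∈ 𝔪 → a + b ∈ 𝔪
      𝔪-+-closed = *ᴼ-closed⇒+-closed 𝔪-resp-≈ proj₁ 𝔪-*-closedʳ

      1-𝔪∉𝔪 : ∀ {b} → b ∈ 𝔪 → 1# - b ∉ 𝔪
      1-𝔪∉𝔪 {b} b∈𝔪 1-b∈𝔪 = 1∉𝔪 (𝔪-resp-≈
        (solve 1 (λ b → (con (+ 1) :- b) :+ b := con (+ 1)) refl b) (𝔪-+-closed 1-b∈𝔪 b∈𝔪))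

      prime⊆𝔪 : ∀ {q} → IsPrimeIdeal O q → q ⊆ 𝔪
      prime⊆𝔪 q-prime p∈q =
        Q.⊆carrier p∈q , λ (y , y∈O , py≈1) → Q.1∉ (Q.∈-resp-≈ py≈1 (Q.*-closedʳ p∈q y∈O))
        where module Q = PrimeIdeal O-sub q-prime

      module _ {A Q : Pred Carrier 0ℓ} (A-sub : IsSubring A) (Q-prime : IsPrimeIdeal A Q) (Q⊆𝔪 : Q ⊆ 𝔪)
               {z : Carrier} (z∈A : z ∈ A) (z∈𝔪 : z ∈ 𝔪) (z∉Q : z ∉ Q) where
        private
          module SA = Subring A-sub
          module Q = PrimeIdeal A-sub Q-prime

        ^suc-diff-injective : ∀ {i j} → z ^ suc i - z ^ suc j ∈ Q → i ≡ j
        ^suc-diff-injective = tri⇒≡-wlog ℕ.<-cmp Q.-‿sym excluded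
          where
          excluded : ∀ {i j} → i ℕ.< j → z ^ suc i - z ^ suc j ∉ Q
          excluded {i} {j} i<j = factored (^-split z (ℕ.s≤s i<j))
            where
            factored : (∃ λ k → z ^ suc j ≈ z ^ suc i * z ^ suc k) → z ^ suc i - z ^ suc j ∉ Q
            factored (k , zʲ≈zⁱzᵏ) zⁱ-zʲ∈Q =
              [ (λ zⁱ∈Q → z∉Q (Q.^-prime (suc i) z∈A zⁱ∈Q))
              , (λ 1-zᵏ∈Q → 1-𝔪∉𝔪 (^suc∈𝔪 z∈𝔪 k) (Q⊆𝔪 1-zᵏ∈Q)) ]
              (Q.prime (SA.^-closed (suc i) z∈A) (SA.-‿closed SA.1∈ (SA.^-closed (suc k) z∈A))
                       (Q.∈-resp-≈ (trans (+-congˡ (-‿cong zʲ≈zⁱzᵏ))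
                                          (solve 2 (λ a b → a :- a :* b := a :* (con (+ 1) :- b)) refl _ _))
                                   zⁱ-zʲ∈Q))

      -- The radical of the O-ideal generated by P, whose elements in a valuation ring are the p·o.
      Rad : Pred Carrier 0ℓ → Pred Carrier 0ℓ
      Rad P x = x ∈ O × ∃ λ n → ∃ λ p → ∃ λ o → p ∈ P × o ∈ O × x ^ suc n ≈ p * o

      module _ {P : Pred Carrier 0ℓ} where
        Rad-resp-≈ : Respects≈ (Rad P)
        Rad-resp-≈ x≈y (x∈O , n , p , o , p∈P , o∈O , xⁿ≈po) =
          SO.∈-resp-≈ x≈y x∈O , n , p , o , p∈P , o∈O , trans (^-congˡ (suc n) (sym x≈y)) xⁿ≈po

        Rad-*-closedʳ : ∀ {x c} → x ∈ Rad P → c ∈ O → x * c ∈ Rad P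
        Rad-*-closedʳ {x} {c} (x∈O , n , p , o , p∈P , o∈O , xⁿ≈po) c∈O =
          SO.*-closed x∈O c∈O , n , p , o * c ^ suc n , p∈P , SO.*-closed o∈O (SO.^-closed (suc n) c∈O) ,
          trans (^-distrib-* x c (suc n)) (trans (*-congʳ xⁿ≈po) (*-assoc p o _))

        Rad-multiple : ∀ {x y w} → y ∈ O → w ∈ O → y ≈ x * w → x * y ∈ Rad P → y ∈ Rad P
        Rad-multiple {x} {y} {w} y∈O w∈O y≈xw (_ , n , p , o , p∈P , o∈O , xyⁿ≈po) =
          y∈O , n ℕ.+ suc n , p , o * w ^ suc n , p∈P , SO.*-closed o∈O (SO.^-closed (suc n) w∈O) , (begin
            y ^ (suc n ℕ.+ suc n)                 ≈⟨ ^-homo-* y (suc n) (suc n) ⟩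
            y ^ suc n * y ^ suc n                 ≈⟨ *-congˡ (trans (^-congˡ (suc n) y≈xw) (^-distrib-* x w (suc n))) ⟩
            y ^ suc n * (x ^ suc n * w ^ suc n)   ≈⟨ solve 3 (λ a b c → a :* (b :* c) := (b :* a) :* c) refl _ _ _ ⟩
            (x ^ suc n * y ^ suc n) * w ^ suc n   ≈⟨ *-congʳ (trans (sym (^-distrib-* x y (suc n))) xyⁿ≈po) ⟩
            (p * o) * w ^ suc n                   ≈⟨ *-assoc p o _ ⟩
            p * (o * w ^ suc n)                   ∎)

        Rad-prime : ∀ {x y} → x ∈ O → y ∈ O → x * y ∈ Rad P → x ∈ Rad P ⊎ y ∈ Rad P
        Rad-prime x∈O y∈O xy∈Rad with ∣ᴼ-total x∈O y∈O
        ... | inj₁ (w , w∈O , y≈xw) = inj₂ (Rad-multiple y∈O w∈O y≈xw xy∈Rad)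
        ... | inj₂ (w , w∈O , x≈yw) = inj₁ (Rad-multiple x∈O w∈O x≈yw (Rad-resp-≈ (*-comm _ _) xy∈Rad))

        Rad-isPrime : 0# ∈ P → P ⊆ 𝔪 → IsPrimeIdeal O (Rad P)
        Rad-isPrime 0∈P P⊆𝔪 =
          ((Rad-resp-≈ , proj₁ , 0∈Rad , *ᴼ-closed⇒+-closed Rad-resp-≈ proj₁ Rad-*-closedʳ , *-closedˡ) , 1∉Rad) ,
          Rad-prime
          where
          0∈Rad : 0# ∈ Rad P
          0∈Rad = SO.0∈ , 0 , 0# , 1# , 0∈P , SO.1∈ , refl
          *-closedˡ : ∀ {a x} → a ∈ O → x ∈ Rad P → a * x ∈ Rad P
          *-closedˡ a∈O x∈Rad = Rad-resp-≈ (*-comm _ _) (Rad-*-closedʳ x∈Rad a∈O)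
          1∉Rad : 1# ∉ Rad P
          1∉Rad (_ , n , p , o , p∈P , o∈O , 1ⁿ≈po) =
            proj₂ (P⊆𝔪 p∈P) (o , o∈O , trans (sym 1ⁿ≈po) (1#^n≈1# (suc n)))

        ⊆Rad : P ⊆ O → P ⊆ Rad P
        ⊆Rad P⊆O {p} p∈P = P⊆O p∈P , 0 , p , 1# , p∈P , SO.1∈ , refl

        Rad-least : ∀ {q} → IsPrimeIdeal O q → P ⊆ q → Rad P ⊆ q
        Rad-least q-prime P⊆q (x∈O , n , p , o , p∈P , o∈O , xⁿ≈po) =
          Q.^-prime (suc n) x∈O (Q.∈-resp-≈ (sym xⁿ≈po) (Q.*-closedʳ (P⊆q p∈P) o∈O))
          where module Q = PrimeIdeal O-sub q-prime

      module _ {R : Pred Carrier 0ℓ} (R-sub : IsSubring R) (R⊆O : R ⊆ O) (dpm : Sem.DPMinimal R O) where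
        open Sem R O
        private module SR = Subring R-sub

        data Sym : Set where
          `R `O : Sym

        ⟦_⟧ˢ : Sym → Pred Carrier 0ℓ
        ⟦ `R ⟧ˢ = R
        ⟦ `O ⟧ˢ = O

        ⟦⟧ˢ-sub : ∀ s → IsSubring ⟦ s ⟧ˢ
        ⟦⟧ˢ-sub `R = R-sub
        ⟦⟧ˢ-sub `O = O-sub

        _∈ᶠ_ : ∀ {n} → Term n → Sym → Formula n
        t ∈ᶠ `R = inR t
        t ∈ᶠ `O = inO t

        -- (c − a)·e, with c the object variable and (a, e) the parameters.
        scaled-diff : Term 3
        scaled-diff = mul (add (var fzero) (neg (var (fsuc fzero)))) (var (fsuc (fsuc fzero)))

        ⟨_,_⟩ : Carrier → Carrier → Fin 2 → Carrier
        ⟨ a , e ⟩ fzero        = a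
        ⟨ a , e ⟩ (fsuc fzero) = e

        Sat-scaled-diff : ∀ s c a e → Sat (c ∷ₑ ⟨ a , e ⟩) (scaled-diff ∈ᶠ s) ⇔ (c - a) * e ∈ ⟦ s ⟧ˢ
        Sat-scaled-diff `R c a e = mk⇔ id id
        Sat-scaled-diff `O c a e = mk⇔ id id

        coset-test : ∀ {S : Pred Carrier 0ℓ} {n} → IsSubring S → (x : Fin n → Carrier) {y e : Carrier} →
          y * e ∈ S → (∀ {i i′} → (x i - x i′) * e ∈ S → i ≡ i′) →
          ∀ {c} i → c ≈ x i + y → ∀ i′ → (c - x i′) * e ∈ S ⇔ i′ ≡ i
        coset-test S-sub x {y} {e} ye∈S x-separated {c} i c≈xi+y i′ = mk⇔
          (λ [c-xi′]e∈S → ≡.sym (x-separated (SS.∈-resp-≈ (to-diff i′) (SS.-‿closed [c-xi′]e∈S ye∈S))))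
          (λ { ≡.refl → SS.∈-resp-≈ (sym (trans (*-congʳ (+-congʳ c≈xi+y))
                          (solve 3 (λ a b e → (a :+ b :- a) :* e := b :* e) refl (x i) y e))) ye∈S })
          where
          module SS = Subring S-sub
          to-diff : ∀ i′ → (c - x i′) * e - y * e ≈ (x i - x i′) * e
          to-diff i′ = trans (+-congʳ (*-congʳ (+-congʳ c≈xi+y)))
            (solve 4 (λ a b a′ e → (a :+ b :- a′) :* e :- b :* e := (a :- a′) :* e) refl (x i) y (x i′) e)

        record ICTGrid (s₁ s₂ : Sym) (n : ℕ) : Set where
          field
            x y         : Fin n → Carrier
            e₁ e₂       : Carrier
            y-in        : ∀ j → y j * e₁ ∈ ⟦ s₁ ⟧ˢ
            x-in        : ∀ i → x i * e₂ ∈ ⟦ s₂ ⟧ˢ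
            x-separated : ∀ {i i′} → (x i - x i′) * e₁ ∈ ⟦ s₁ ⟧ˢ → i ≡ i′
            y-separated : ∀ {j j′} → (y j - y j′) * e₂ ∈ ⟦ s₂ ⟧ˢ → j ≡ j′

        no-ICTGrid : ∀ s₁ s₂ → ¬ (∀ n → ICTGrid s₁ s₂ n)
        no-ICTGrid s₁ s₂ grid = dpm (2 , 2 , scaled-diff ∈ᶠ s₁ , scaled-diff ∈ᶠ s₂ , ict-pattern)
          where
          ict-pattern : ∀ n → Σ (Fin n → Fin 2 → Carrier) λ a → Σ (Fin n → Fin 2 → Carrier) λ b →
            ∀ i j → ∃ λ c → (∀ i′ → Sat (c ∷ₑ a i′) (scaled-diff ∈ᶠ s₁) ⇔ i′ ≡ i)
                          × (∀ j′ → Sat (c ∷ₑ b j′) (scaled-diff ∈ᶠ s₂) ⇔ j′ ≡ j)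
          ict-pattern n = (λ i → ⟨ x i , e₁ ⟩) , (λ j → ⟨ y j , e₂ ⟩) , λ i j → x i + y j ,
            (λ i′ → ⇔-trans (Sat-scaled-diff s₁ _ _ _) (coset-test (⟦⟧ˢ-sub s₁) x (y-in j) x-separated i refl i′)) ,
            (λ j′ → ⇔-trans (Sat-scaled-diff s₂ _ _ _) (coset-test (⟦⟧ˢ-sub s₂) y (x-in i) y-separated j (+-comm _ _) j′))
            where open ICTGrid (grid n)

        -- Since uⁿ ≡ 1 mod w, (xᵢ − xᵢ′)·w⁻ⁿ ∈ R with i < i′ would make w a unit of R.
        module ComaximalFamily {u w : Carrier} (u∈R : u ∈ R) (w∈R : w ∈ R) (u+w≈1 : u + w ≈ 1#)
                               (w-nonunit : ¬ Unit R w) (w≉0 : w ≉ 0#) where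
          u^k∈1+wR : ∀ k → ∃ λ g → g ∈ R × u ^ k ≈ 1# + w * g
          u^k∈1+wR zero    = 0# , SR.0∈ , trans (sym (+-identityʳ 1#)) (+-congˡ (sym (zeroʳ w)))
          u^k∈1+wR (suc k) with u^k∈1+wR k
          ... | g , g∈R , uᵏ≈1+wg =
            g - 1# - w * g , SR.-‿closed (SR.-‿closed g∈R SR.1∈) (SR.*-closed w∈R g∈R) , (begin
              u * u ^ k                         ≈⟨ *-cong u≈1-w uᵏ≈1+wg ⟩
              (1# - w) * (1# + w * g)           ≈⟨ solve 2 (λ w g → (con (+ 1) :- w) :* (con (+ 1) :+ w :* g)
                                                     := con (+ 1) :+ w :* (g :- con (+ 1) :- w :* g)) refl w g ⟩
              1# + w * (g - 1# - w * g)         ∎)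
            where
            u≈1-w : u ≈ 1# - w
            u≈1-w = trans (solve 2 (λ u w → u := (u :+ w) :- w) refl u w) (+-congʳ u+w≈1)

          module _ (n : ℕ) where
            w⁻ⁿ : Carrier
            w⁻ⁿ = proj₁ (inverse (w ^ n) (^-≉0 w≉0 n))

            wⁿw⁻ⁿ≈1 : w ^ n * w⁻ⁿ ≈ 1#
            wⁿw⁻ⁿ≈1 = proj₂ (inverse (w ^ n) (^-≉0 w≉0 n))

            x : Fin n → Carrier
            x i = u ^ n * w ^ toℕ i

            wⁿuᵏw⁻ⁿ∈R : ∀ k → (w ^ n * u ^ k) * w⁻ⁿ ∈ R
            wⁿuᵏw⁻ⁿ∈R k = SR.∈-resp-≈ (sym (begin
              (w ^ n * u ^ k) * w⁻ⁿ   ≈⟨ solve 3 (λ a b c → (a :* b) :* c := b :* (a :* c)) refl _ _ _ ⟩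
              u ^ k * (w ^ n * w⁻ⁿ)   ≈⟨ *-congˡ wⁿw⁻ⁿ≈1 ⟩
              u ^ k * 1#              ≈⟨ *-identityʳ _ ⟩
              u ^ k                   ∎)) (SR.^-closed k u∈R)

            x-separated : ∀ {i i′} → (x i - x i′) * w⁻ⁿ ∈ R → i ≡ i′
            x-separated = tri⇒≡-wlog Fin.<-cmp SR.-‿*-sym excluded
              where
              excluded : ∀ {i i′} → i Fin.< i′ → (x i - x i′) * w⁻ⁿ ∉ R
              excluded {i} {i′} i<i′ r∈R = w-nonunit (w-unit (^-split w i<i′) (^-split w (Fin.toℕ<n i)) (u^k∈1+wR n))
                where
                r : Carrier
                r = (x i - x i′) * w⁻ⁿ

                w-unit : (∃ λ k → w ^ toℕ i′ ≈ w ^ toℕ i * w ^ suc k) → (∃ λ d → w ^ n ≈ w ^ toℕ i * w ^ suc d) →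
                  (∃ λ g → g ∈ R × u ^ n ≈ 1# + w * g) → Unit R w
                w-unit (k , wⁱ′≈wⁱwᵏ) (d , wⁿ≈wⁱwᵈ) (g , g∈R , uⁿ≈1+wg) = t , t∈R , wt≈1
                  where
                  wⁱ : Carrier
                  wⁱ = w ^ toℕ i

                  t : Carrier
                  t = w ^ d * r - g + w ^ k + w * g * w ^ k

                  t∈R : t ∈ R
                  t∈R = SR.+-closed (SR.+-closed (SR.-‿closed (SR.*-closed (SR.^-closed d w∈R) r∈R) g∈R)
                                                 (SR.^-closed k w∈R))
                                    (SR.*-closed (SR.*-closed w∈R g∈R) (SR.^-closed k w∈R))

                  scaled : wⁱ * ((1# + w * g) * (1# - w ^ suc k)) ≈ wⁱ * (w * (w ^ d * r))
                  scaled = begin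
                    wⁱ * ((1# + w * g) * (1# - w ^ suc k))  ≈⟨ *-congˡ (*-congʳ uⁿ≈1+wg) ⟨
                    wⁱ * (u ^ n * (1# - w ^ suc k))         ≈⟨ solve 3 (λ a b c → a :* (b :* (con (+ 1) :- c))
                                                                 := b :* a :- b :* (a :* c)) refl wⁱ (u ^ n) (w ^ suc k) ⟩
                    u ^ n * wⁱ - u ^ n * (wⁱ * w ^ suc k)   ≈⟨ +-congˡ (-‿cong (*-congˡ wⁱ′≈wⁱwᵏ)) ⟨
                    x i - x i′                              ≈⟨ *-identityˡ _ ⟨
                    1# * (x i - x i′)                       ≈⟨ *-congʳ wⁿw⁻ⁿ≈1 ⟨
                    (w ^ n * w⁻ⁿ) * (x i - x i′)            ≈⟨ solve 3 (λ a b c → (a :* b) :* c := a :* (c :* b)) refl _ _ _ ⟩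
                    w ^ n * r                               ≈⟨ *-congʳ wⁿ≈wⁱwᵈ ⟩
                    (wⁱ * w ^ suc d) * r                    ≈⟨ solve 4 (λ a w b r → (a :* (w :* b)) :* r := a :* (w :* (b :* r)))
                                                                 refl wⁱ w (w ^ d) r ⟩
                    wⁱ * (w * (w ^ d * r))                  ∎

                  wt≈1 : w * t ≈ 1#
                  wt≈1 = begin
                    w * t                                                       ≈⟨ solve 5 (λ w b r g c →
                        w :* (b :* r :- g :+ c :+ w :* g :* c)
                        := w :* (b :* r) :- (con (+ 1) :+ w :* g) :* (con (+ 1) :- w :* c) :+ con (+ 1))
                        refl w (w ^ d) r g (w ^ k) ⟩
                    w * (w ^ d * r) - (1# + w * g) * (1# - w ^ suc k) + 1#      ≈⟨ +-congʳ (+-congˡ (-‿cong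
                                                                                    (*-cancelˡ-≉0 (^-≉0 w≉0 (toℕ i)) scaled))) ⟩
                    w * (w ^ d * r) - w * (w ^ d * r) + 1#                      ≈⟨ +-congʳ (-‿inverseʳ _) ⟩
                    0# + 1#                                                     ≈⟨ +-identityˡ 1# ⟩
                    1#                                                          ∎

        nonunits-not-comaximal : ∀ {u w} → u ∈ R → w ∈ R → u + w ≈ 1# → ¬ Unit R u → ¬ Unit R w → ⊥
        nonunits-not-comaximal {u} {w} u∈R w∈R u+w≈1 u-nonunit w-nonunit = no-ICTGrid `R `R grid
          where
          w≉0 : w ≉ 0#
          w≉0 w≈0 = u-nonunit (1# , SR.1∈ , (begin
            u * 1#   ≈⟨ *-identityʳ u ⟩
            u        ≈⟨ +-identityʳ u ⟨
            u + 0#   ≈⟨ +-congˡ w≈0 ⟨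
            u + w    ≈⟨ u+w≈1 ⟩
            1#       ∎))
          u≉0 : u ≉ 0#
          u≉0 u≈0 = w-nonunit (1# , SR.1∈ , (begin
            w * 1#   ≈⟨ *-identityʳ w ⟩
            w        ≈⟨ +-identityˡ w ⟨
            0# + w   ≈⟨ +-congʳ u≈0 ⟨
            u + w    ≈⟨ u+w≈1 ⟩
            1#       ∎))
          module U = ComaximalFamily u∈R w∈R u+w≈1 w-nonunit w≉0
          module W = ComaximalFamily w∈R u∈R (trans (+-comm w u) u+w≈1) u-nonunit u≉0
          grid : ∀ n → ICTGrid `R `R n
          grid n = record
            { x = U.x n ; y = W.x n ; e₁ = U.w⁻ⁿ n ; e₂ = W.w⁻ⁿ n
            ; y-in = λ j → U.wⁿuᵏw⁻ⁿ∈R n (toℕ j) ; x-in = λ i → W.wⁿuᵏw⁻ⁿ∈R n (toℕ i)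
            ; x-separated = U.x-separated n ; y-separated = W.x-separated n }

        module _ {P : Pred Carrier 0ℓ} (P-prime : IsPrimeIdeal R P) (P⊆𝔪 : P ⊆ 𝔪) where
          private module PR = PrimeIdeal R-sub P-prime

          -- xᵢ = p·sⁱ⁻ⁿ⁻¹: xᵢ − xᵢ′ ∈ O would put 1 − sᵏ⁺¹ into 𝔪, and (yⱼ − yⱼ′)·e ∈ R
          -- would put sʲ⁺¹ − sʲ′⁺¹ into P.
          module ExtensionFamily {s p u : Carrier} (s∈R : s ∈ R) (s∈𝔪 : s ∈ 𝔪) (s∉P : s ∉ P)
                                 (p∈P : p ∈ P) (u∈O : u ∈ O) (s≈pu : s ≈ p * u) where
            p≉0 : p ≉ 0#
            p≉0 p≈0 = s∉P (PR.∈-resp-≈ (sym (trans s≈pu (trans (*-congʳ p≈0) (zeroˡ u)))) PR.0∈)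

            s≉0 : s ≉ 0#
            s≉0 s≈0 = s∉P (PR.∈-resp-≈ (sym s≈0) PR.0∈)

            p⁻¹ : Carrier
            p⁻¹ = proj₁ (inverse p p≉0)

            pp⁻¹≈1 : p * p⁻¹ ≈ 1#
            pp⁻¹≈1 = proj₂ (inverse p p≉0)

            module _ (n : ℕ) where
              s⁻ⁿ : Carrier
              s⁻ⁿ = proj₁ (inverse (s ^ suc n) (^-≉0 s≉0 (suc n)))

              sⁿs⁻ⁿ≈1 : s ^ suc n * s⁻ⁿ ≈ 1#
              sⁿs⁻ⁿ≈1 = proj₂ (inverse (s ^ suc n) (^-≉0 s≉0 (suc n)))

              x : Fin n → Carrier
              x i = (p * s⁻ⁿ) * s ^ toℕ i

              y : Fin n → Carrier
              y j = s ^ suc (toℕ j)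

              e : Carrier
              e = s ^ suc n * p⁻¹

              cancel-p⁻¹ : ∀ a → (a * e) * p ≈ a * s ^ suc n
              cancel-p⁻¹ a = begin
                (a * (s ^ suc n * p⁻¹)) * p   ≈⟨ solve 4 (λ a b q p → (a :* (b :* q)) :* p := (a :* b) :* (p :* q))
                                                         refl a (s ^ suc n) p⁻¹ p ⟩
                (a * s ^ suc n) * (p * p⁻¹)   ≈⟨ *-congˡ pp⁻¹≈1 ⟩
                (a * s ^ suc n) * 1#          ≈⟨ *-identityʳ _ ⟩
                a * s ^ suc n                 ∎

              y-in : ∀ j → y j * 1# ∈ O
              y-in j = SO.∈-resp-≈ (sym (*-identityʳ _)) (R⊆O (SR.^-closed (suc (toℕ j)) s∈R))

              x-in : ∀ i → x i * e ∈ R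
              x-in i = SR.∈-resp-≈ (sym (begin
                ((p * s⁻ⁿ) * s ^ toℕ i) * (s ^ suc n * p⁻¹)  ≈⟨ solve 5 (λ p t a b q → ((p :* t) :* a) :* (b :* q)
                                                                  := a :* ((p :* q) :* (b :* t)))
                                                                  refl p s⁻ⁿ (s ^ toℕ i) (s ^ suc n) p⁻¹ ⟩
                s ^ toℕ i * ((p * p⁻¹) * (s ^ suc n * s⁻ⁿ))  ≈⟨ *-congˡ (*-cong pp⁻¹≈1 sⁿs⁻ⁿ≈1) ⟩
                s ^ toℕ i * (1# * 1#)                       ≈⟨ *-congˡ (*-identityˡ 1#) ⟩
                s ^ toℕ i * 1#                              ≈⟨ *-identityʳ _ ⟩
                s ^ toℕ i                                   ∎)) (SR.^-closed (toℕ i) s∈R)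

              x-separated : ∀ {i i′} → (x i - x i′) * 1# ∈ O → i ≡ i′
              x-separated = tri⇒≡-wlog Fin.<-cmp SO.-‿*-sym excluded
                where
                excluded : ∀ {i i′} → i Fin.< i′ → (x i - x i′) * 1# ∉ O
                excluded {i} {i′} i<i′ = unwound (^-split s i<i′) (^-split s (Fin.toℕ<n i))
                  where
                  unwound : (∃ λ k → s ^ toℕ i′ ≈ s ^ toℕ i * s ^ suc k) →
                    (∃ λ d → s ^ n ≈ s ^ toℕ i * s ^ suc d) → (x i - x i′) * 1# ∉ O
                  unwound (k , sⁱ′≈sⁱsᵏ) (d , sⁿ≈sⁱsᵈ) δ∈O =
                    1-𝔪∉𝔪 (^suc∈𝔪 s∈𝔪 k)
                      (𝔪-resp-≈ unwinds (𝔪-*-closedʳ (^suc∈𝔪 s∈𝔪 d) (SO.*-closed δ∈O u∈O)))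
                    where
                    sⁱ : Carrier
                    sⁱ = s ^ toℕ i

                    unwinds : s ^ suc d * (((x i - x i′) * 1#) * u) ≈ 1# - s ^ suc k
                    unwinds = begin
                      s ^ suc d * (((x i - x i′) * 1#) * u)
                        ≈⟨ *-congˡ (*-congʳ (trans (*-identityʳ _) (+-congˡ (-‿cong (*-congˡ sⁱ′≈sⁱsᵏ))))) ⟩
                      s ^ suc d * (((p * s⁻ⁿ) * sⁱ - (p * s⁻ⁿ) * (sⁱ * s ^ suc k)) * u)
                        ≈⟨ *-congˡ (*-congʳ (solve 3 (λ m a b → m :* a :- m :* (a :* b) := m :* a :* (con (+ 1) :- b))
                                                     refl (p * s⁻ⁿ) sⁱ (s ^ suc k))) ⟩
                      s ^ suc d * (((p * s⁻ⁿ) * sⁱ * (1# - s ^ suc k)) * u)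
                        ≈⟨ solve 6 (λ p t a b c u → c :* ((p :* t) :* a :* b :* u) := ((p :* u) :* (t :* (a :* c))) :* b)
                                   refl p s⁻ⁿ sⁱ (1# - s ^ suc k) (s ^ suc d) u ⟩
                      ((p * u) * (s⁻ⁿ * (sⁱ * s ^ suc d))) * (1# - s ^ suc k)
                        ≈⟨ *-congʳ (*-cong (sym s≈pu) (*-congˡ (sym sⁿ≈sⁱsᵈ))) ⟩
                      (s * (s⁻ⁿ * s ^ n)) * (1# - s ^ suc k)
                        ≈⟨ *-congʳ (trans (solve 3 (λ s t a → s :* (t :* a) := (s :* a) :* t) refl s s⁻ⁿ (s ^ n))
                                          sⁿs⁻ⁿ≈1) ⟩
                      1# * (1# - s ^ suc k)
                        ≈⟨ *-identityˡ _ ⟩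
                      1# - s ^ suc k ∎

              y-separated : ∀ {j j′} → (y j - y j′) * e ∈ R → j ≡ j′
              y-separated {j} {j′} δe∈R =
                [ diff-injective , (λ sⁿ∈P → ⊥-elim (s∉P (PR.^-prime (suc n) s∈R sⁿ∈P))) ]
                (PR.prime (SR.-‿closed (SR.^-closed (suc (toℕ j)) s∈R) (SR.^-closed (suc (toℕ j′)) s∈R))
                          (SR.^-closed (suc n) s∈R)
                          (PR.∈-resp-≈ (cancel-p⁻¹ (y j - y j′)) (PR.*-closedˡ δe∈R p∈P)))
                where
                diff-injective : y j - y j′ ∈ P → j ≡ j′
                diff-injective δ∈P = Fin.toℕ-injective (^suc-diff-injective R-sub P-prime P⊆𝔪 s∈R s∈𝔪 s∉P δ∈P)

          PO∩R⊆P : ∀ {s p u} → s ∈ R → p ∈ P → u ∈ O → s ≈ p * u → s ∈ P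
          PO∩R⊆P {s} {p} {u} s∈R p∈P u∈O s≈pu with em {s ∈ P} | em {Unit O s}
          ... | yes s∈P | _ = s∈P
          ... | no s∉P | yes (t , t∈O , st≈1) = ⊥-elim (proj₂ (P⊆𝔪 p∈P)
            (u * t , SO.*-closed u∈O t∈O , trans (sym (*-assoc p u t)) (trans (*-congʳ (sym s≈pu)) st≈1)))
          ... | no s∉P | no s-nonunit = ⊥-elim (no-ICTGrid `O `R grid)
            where
            module E = ExtensionFamily s∈R (R⊆O s∈R , s-nonunit) s∉P p∈P u∈O s≈pu
            grid : ∀ n → ICTGrid `O `R n
            grid n = record
              { x = E.x n ; y = E.y n ; e₁ = 1# ; e₂ = E.e n ; y-in = E.y-in n ; x-in = E.x-in n
              ; x-separated = E.x-separated n ; y-separated = E.y-separated n }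

          Rad∩R⊆ : Rad P ∩ R ⊆ P
          Rad∩R⊆ ((_ , n , p , o , p∈P , o∈O , xⁿ≈po) , x∈R) =
            PR.^-prime (suc n) x∈R (PO∩R⊆P (SR.^-closed (suc n) x∈R) p∈P o∈O xⁿ≈po)

        module _ {q q′ : Pred Carrier 0ℓ} (q-prime : IsPrimeIdeal O q) (q′-prime : IsPrimeIdeal O q′) where
          private
            module Q  = PrimeIdeal O-sub q-prime
            module Q′ = PrimeIdeal O-sub q′-prime

          module GapFamily {a m : Carrier} (a∈q′ : a ∈ q′) (a∉q : a ∉ q) (m∈R : m ∈ R) (m∈𝔪 : m ∈ 𝔪)
                           (m∉q : m ∉ q) (q′∩R⊆q : q′ ∩ R ⊆ q) where
            a∈O : a ∈ O
            a∈O = Q′.⊆carrier a∈q′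

            a≉0 : a ≉ 0#
            a≉0 a≈0 = a∉q (Q.∈-resp-≈ (sym a≈0) Q.0∈)

            a⁻¹ : Carrier
            a⁻¹ = proj₁ (inverse a a≉0)

            aa⁻¹≈1 : a * a⁻¹ ≈ 1#
            aa⁻¹≈1 = proj₂ (inverse a a≉0)

            module _ (n : ℕ) where
              x : Fin n → Carrier
              x i = m ^ suc (toℕ i)

              y : Fin n → Carrier
              y j = a ^ suc (toℕ j)

              y-in : ∀ j → y j * a⁻¹ ∈ O
              y-in j = SO.∈-resp-≈ (sym (trans (solve 3 (λ a b c → (a :* b) :* c := b :* (a :* c)) refl a (a ^ toℕ j) a⁻¹)
                                               (trans (*-congˡ aa⁻¹≈1) (*-identityʳ _))))
                                   (SO.^-closed (toℕ j) a∈O)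

              x-in : ∀ i → x i * 1# ∈ R
              x-in i = SR.∈-resp-≈ (sym (*-identityʳ _)) (SR.^-closed (suc (toℕ i)) m∈R)

              x-separated : ∀ {i i′} → (x i - x i′) * a⁻¹ ∈ O → i ≡ i′
              x-separated {i} {i′} δa⁻¹∈O = Fin.toℕ-injective
                (^suc-diff-injective O-sub q-prime (prime⊆𝔪 q-prime) (R⊆O m∈R) m∈𝔪 m∉q (q′∩R⊆q (δ∈q′ , δ∈R)))
                where
                δ∈R : x i - x i′ ∈ R
                δ∈R = SR.-‿closed (SR.^-closed (suc (toℕ i)) m∈R) (SR.^-closed (suc (toℕ i′)) m∈R)
                δ∈q′ : x i - x i′ ∈ q′
                δ∈q′ = Q′.∈-resp-≈ (trans (solve 3 (λ d b a → (d :* b) :* a := d :* (a :* b)) refl _ a⁻¹ a)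
                                          (trans (*-congˡ aa⁻¹≈1) (*-identityʳ _)))
                                   (Q′.*-closedˡ δa⁻¹∈O a∈q′)

              y-separated : ∀ {j j′} → (y j - y j′) * 1# ∈ R → j ≡ j′
              y-separated {j} {j′} δ∈R = Fin.toℕ-injective
                (^suc-diff-injective O-sub q-prime (prime⊆𝔪 q-prime) a∈O (prime⊆𝔪 q′-prime a∈q′) a∉q
                  (q′∩R⊆q (δ∈q′ , SR.∈-resp-≈ (*-identityʳ _) δ∈R)))
                where
                δ∈q′ : y j - y j′ ∈ q′
                δ∈q′ = Q′.-‿closed (Q′.*-closedʳ a∈q′ (SO.^-closed (toℕ j) a∈O))
                                   (Q′.*-closedʳ a∈q′ (SO.^-closed (toℕ j′) a∈O))

          R-meets-gap : ∀ {a m} → a ∈ q′ → a ∉ q → m ∈ R → m ∈ 𝔪 → m ∉ q → ∃ λ r → r ∈ q′ ∩ R × r ∉ q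
          R-meets-gap a∈q′ a∉q m∈R m∈𝔪 m∉q with em {∃ λ r → r ∈ q′ ∩ R × r ∉ q}
          ... | yes gap   = gap
          ... | no no-gap = ⊥-elim (no-ICTGrid `O `R grid)
            where
            q′∩R⊆q : q′ ∩ R ⊆ q
            q′∩R⊆q {r} r∈q′∩R = em⇒dne em (λ r∉q → no-gap (r , r∈q′∩R , r∉q))
            module G = GapFamily a∈q′ a∉q m∈R m∈𝔪 m∉q q′∩R⊆q
            grid : ∀ n → ICTGrid `O `R n
            grid n = record
              { x = G.x n ; y = G.y n ; e₁ = G.a⁻¹ ; e₂ = 1# ; y-in = G.y-in n ; x-in = G.x-in n
              ; x-separated = G.x-separated n ; y-separated = G.y-separated n }

        module _ {M : Pred Carrier 0ℓ} (M-local : IsLocalWith R M) (M⊆𝔪 : M ⊆ 𝔪) where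
          private
            M-proper : IsProperIdeal R M
            M-proper = proj₁ (proj₁ M-local)

            module MI = Ideal (proj₁ M-proper)

          M+xR : Carrier → Pred Carrier 0ℓ
          M+xR x y = ∃ λ m → ∃ λ r → m ∈ M × r ∈ R × y ≈ m + x * r

          M+xR-ideal : ∀ {x} → x ∈ R → IsIdeal R (M+xR x)
          M+xR-ideal {x} x∈R = resp , ⊆R , zero∈ , plus , times
            where
            resp : Respects≈ (M+xR x)
            resp y≈z (m , r , m∈M , r∈R , y≈m+xr) = m , r , m∈M , r∈R , trans (sym y≈z) y≈m+xr
            ⊆R : M+xR x ⊆ R
            ⊆R (m , r , m∈M , r∈R , y≈m+xr) =
              SR.∈-resp-≈ (sym y≈m+xr) (SR.+-closed (MI.⊆carrier m∈M) (SR.*-closed x∈R r∈R))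
            zero∈ : 0# ∈ M+xR x
            zero∈ = 0# , 0# , MI.0∈ , SR.0∈ , trans (sym (+-identityʳ 0#)) (+-congˡ (sym (zeroʳ x)))
            plus : ∀ {y z} → y ∈ M+xR x → z ∈ M+xR x → y + z ∈ M+xR x
            plus (m , r , m∈M , r∈R , y≈) (m′ , r′ , m′∈M , r′∈R , z≈) =
              m + m′ , r + r′ , MI.+-closed m∈M m′∈M , SR.+-closed r∈R r′∈R ,
              trans (+-cong y≈ z≈) (solve 5 (λ m x r m′ r′ → (m :+ x :* r) :+ (m′ :+ x :* r′)
                                               := (m :+ m′) :+ x :* (r :+ r′)) refl m x r m′ r′)
            times : ∀ {a y} → a ∈ R → y ∈ M+xR x → a * y ∈ M+xR x
            times {a} a∈R (m , r , m∈M , r∈R , y≈) =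
              a * m , a * r , MI.*-closedˡ a∈R m∈M , SR.*-closed a∈R r∈R ,
              trans (*-congˡ y≈) (solve 4 (λ a m x r → a :* (m :+ x :* r) := a :* m :+ x :* (a :* r)) refl a m x r)

          -- Without Zorn's lemma a non-unit of R need not lie in the unique maximal ideal M;
          -- comaximal non-units are excluded by dp-minimality instead.
          O-unit⇒R-unit : ∀ {x} → x ∈ R → Unit O x → Unit R x
          O-unit⇒R-unit {x} x∈R x-unitᴼ with em {Unit R x} | em {1# ∈ M+xR x}
          ... | yes x-unit | _ = x-unit
          ... | no _ | no 1∉M+xR = ⊥-elim (proj₂ (M⊆𝔪 x∈M) x-unitᴼ)
            where
            M⊆M+xR : M ⊆ M+xR x
            M⊆M+xR {m} m∈M = m , 0# , m∈M , SR.0∈ , trans (sym (+-identityʳ m)) (+-congˡ (sym (zeroʳ x)))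
            x∈M+xR : x ∈ M+xR x
            x∈M+xR = 0# , 1# , MI.0∈ , SR.1∈ , trans (sym (*-identityʳ x)) (sym (+-identityˡ _))
            x∈M : x ∈ M
            x∈M = proj₂ (proj₁ M-local) (M+xR x) (M+xR-ideal x∈R , 1∉M+xR) M⊆M+xR x∈M+xR
          ... | no x-nonunit | yes (m , r , m∈M , r∈R , 1≈m+xr) =
            ⊥-elim (nonunits-not-comaximal (SR.*-closed x∈R r∈R) (MI.⊆carrier m∈M) (trans (+-comm _ _) (sym 1≈m+xr))
                      xr-nonunit m-nonunit)
            where
            xr-nonunit : ¬ Unit R (x * r)
            xr-nonunit (t , t∈R , xrt≈1) = x-nonunit (r * t , SR.*-closed r∈R t∈R , trans (sym (*-assoc x r t)) xrt≈1)
            m-nonunit : ¬ Unit R m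
            m-nonunit (t , t∈R , mt≈1) = proj₂ M-proper (MI.∈-resp-≈ mt≈1 (MI.*-closedʳ m∈M t∈R))

          R-prime⊆𝔪 : ∀ {P} → IsPrimeIdeal R P → P ⊆ 𝔪
          R-prime⊆𝔪 P-prime {p} p∈P =
            R⊆O (PR.⊆carrier p∈P) , λ p-unitᴼ → p-nonunit (O-unit⇒R-unit (PR.⊆carrier p∈P) p-unitᴼ)
            where
            module PR = PrimeIdeal R-sub P-prime
            p-nonunit : ¬ Unit R p
            p-nonunit (y , y∈R , py≈1) = PR.1∉ (PR.∈-resp-≈ py≈1 (PR.*-closedʳ p∈P y∈R))

          Rad-isPrimeᴿ : ∀ {P} → IsPrimeIdeal R P → IsPrimeIdeal O (Rad P)
          Rad-isPrimeᴿ P-prime = Rad-isPrime (PrimeIdeal.0∈ R-sub P-prime) (R-prime⊆𝔪 P-prime)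

          Rad-Consecutive : ∀ {A B} → IsPrimeIdeal R A → IsPrimeIdeal R B →
            Consecutive R A B → Consecutive O (Rad A) (Rad B)
          Rad-Consecutive {A} {B} A-prime B-prime ((A⊆B , B⊈A) , nothing-between) =
            (RadA⊆RadB , RadB⊈RadA) , nothing-between′
            where
            module PA = PrimeIdeal R-sub A-prime
            module PB = PrimeIdeal R-sub B-prime

            A⊆RadA : A ⊆ Rad A
            A⊆RadA = ⊆Rad (λ a∈A → R⊆O (PA.⊆carrier a∈A))

            B⊆RadB : B ⊆ Rad B
            B⊆RadB = ⊆Rad (λ b∈B → R⊆O (PB.⊆carrier b∈B))

            RadA∩R⊆A : Rad A ∩ R ⊆ A
            RadA∩R⊆A = Rad∩R⊆ A-prime (R-prime⊆𝔪 A-prime)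

            RadA⊆RadB : Rad A ⊆ Rad B
            RadA⊆RadB = Rad-least (Rad-isPrimeᴿ B-prime) (λ a∈A → B⊆RadB (A⊆B a∈A))

            RadB⊈RadA : ¬ (Rad B ⊆ Rad A)
            RadB⊈RadA RadB⊆RadA = B⊈A (λ b∈B → RadA∩R⊆A (RadB⊆RadA (B⊆RadB b∈B) , PB.⊆carrier b∈B))

            nothing-between′ : ¬ (Σ (Pred Carrier 0ℓ) λ T → IsPrimeIdeal O T × (Rad A ⊊ T) × (T ⊊ Rad B))
            nothing-between′ (T , T-prime , (RadA⊆T , T⊈RadA) , (T⊆RadB , RadB⊈T)) = RadB⊈T (Rad-least T-prime B⊆T)
              where
              A⊆T∩R : A ⊆ T ∩ R
              A⊆T∩R a∈A = RadA⊆T (A⊆RadA a∈A) , PA.⊆carrier a∈A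

              T∩R⊆B : T ∩ R ⊆ B
              T∩R⊆B (t∈T , t∈R) = Rad∩R⊆ B-prime (R-prime⊆𝔪 B-prime) (T⊆RadB t∈T , t∈R)

              T∩R⊈A : ¬ (T ∩ R ⊆ A)
              T∩R⊈A T∩R⊆A =
                let (t , t∈T , t∉RadA) = ⊈⇒∃∉ em T⊈RadA
                    (m , m∈B , m∉A)    = ⊈⇒∃∉ em B⊈A
                    m∈R                = PB.⊆carrier m∈B
                    (r , r∈T∩R , r∉RadA) = R-meets-gap (Rad-isPrimeᴿ A-prime) T-prime t∈T t∉RadA m∈R
                                             (R-prime⊆𝔪 B-prime m∈B) (λ m∈RadA → m∉A (RadA∩R⊆A (m∈RadA , m∈R)))
                in r∉RadA (A⊆RadA (T∩R⊆A r∈T∩R))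

              B⊆T : B ⊆ T
              B⊆T b∈B = proj₁ (em⇒dne em (λ B⊈T∩R → nothing-between
                (T ∩ R , ∩-prime R-sub O-sub R⊆O T-prime , (A⊆T∩R , T∩R⊈A) , (T∩R⊆B , B⊈T∩R))) b∈B)

          Star-descends : Star O → Star R
          Star-descends no-chainᴼ (P₁ , P₂ , P₃ , P₁-prime , P₂-prime , P₃-prime , P₁⋖P₂ , P₂⋖P₃) =
            no-chainᴼ (Rad P₁ , Rad P₂ , Rad P₃ ,
                       Rad-isPrimeᴿ P₁-prime , Rad-isPrimeᴿ P₂-prime , Rad-isPrimeᴿ P₃-prime ,
                       Rad-Consecutive P₁-prime P₂-prime P₁⋖P₂ , Rad-Consecutive P₂-prime P₃-prime P₂⋖P₃)

proposition6p7 : ExcludedMiddle 0ℓ → ExcludedMiddle (Level.suc 0ℓ) →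
    (K : CommutativeRing 0ℓ 0ℓ) → Over.IsField K →
    (R M O : Pred (CommutativeRing.Carrier K) 0ℓ) →
    Over.IsSubring K R → Over.IsFractionFieldOf K R →
    Over.IsLocalWith K R M →
    Over.IsValuationRing K O → R ⊆ O →
    M ⊆ Over.NonUnits K O →
    Over.Sem.DPMinimal K R O →
    Over.Star K O → Over.Star K R
proposition6p7 em _ K F R M O R-sub _ M-local O-val R⊆O M⊆𝔪 dpm =
  Star-descends K F em O-val R-sub R⊆O dpm M-local M⊆𝔪
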